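{- For every access sequence $S\in[n]^m$ there is a finite set $X\subset\mathbb Q\setminus[n]$ of auxiliary elements and an algorithm $A$ serving $S$ on a BST $T_A$ with key set $[n]\cup X$ such that, at all times, every element of $[n]$ is a leaf of $T_A$, and the total cost of $A$ on $S$ is at most $3\,\mathrm{OPT}(S)$.
   Context: Dynamic BST model on a finite key set $K\subset\mathbb Q$: an algorithm maintains a BST with key set $K$ (initial tree of its choice); to serve an access to $x$ it touches a connected subtree containing the root and $x$, and may rearrange the touched nodes into any BST shape; the cost of the access is the number of touched nodes. $\mathrm{OPT}(S)$ is the minimum total cost over all offline algorithms serving $S$ with key set $[n]$. -}

module Defs where

open import Data.Nat using (ℕ; zero; suc; _+_; _*_; _≤_)
open import Data.Integer using (+_)
open import Data.Rational using (ℚ; _/_; _<_)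
open import Data.Fin using (Fin; toℕ)
open import Data.List using (List; []; _∷_; _++_; [_]; map)
open import Data.List.Membership.Propositional using (_∈_)
open import Data.List.Relation.Unary.Linked using (Linked)
open import Data.Product using (Σ; ∃; _×_; _,_)
open import Data.Sum using (_⊎_)
open import Data.Unit using (⊤)
open import Function.Bundles using (_⇔_)
open import Relation.Binary.PropositionalEquality using (_≡_)

-- Keys.  The key [k] ∈ [n] = {1,…,n} is the rational number k/1.

ℕtoℚ : ℕ → ℚ
ℕtoℚ k = (+ k) / 1

InRange : ℕ → ℚ → Set
InRange n q = Σ ℕ λ k → (1 ≤ k) × (k ≤ n) × (q ≡ ℕtoℚ k)

-- element i : Fin n of an access sequence denotes the key (toℕ i + 1) ∈ [n]
finKey : {n : ℕ} → Fin n → ℚ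
finKey i = ℕtoℚ (suc (toℕ i))

data Tree : Set where
  empty : Tree
  node  : Tree → ℚ → Tree → Tree

inorder : Tree → List ℚ
inorder empty        = []
inorder (node l k r) = inorder l ++ (k ∷ inorder r)

IsBST : Tree → Set
IsBST t = Linked _<_ (inorder t)

HasKeySet : Tree → (ℚ → Set) → Set
HasKeySet t K = ∀ q → (q ∈ inorder t) ⇔ K q

data LeafIn (q : ℚ) : Tree → Set where
  here  : LeafIn q (node empty q empty)
  left  : ∀ {l k r} → LeafIn q l → LeafIn q (node l k r)
  right : ∀ {l k r} → LeafIn q r → LeafIn q (node l k r)

-- Top parts: a connected subtree containing the root, the positions of
-- the hanging (untouched) subtrees being holes.

data Top : Set where
  hole  : Top
  tnode : Top → ℚ → Top → Top

topKeys : Top → List ℚ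
topKeys hole          = []
topKeys (tnode l k r) = topKeys l ++ (k ∷ topKeys r)

topSize : Top → ℕ
topSize hole          = 0
topSize (tnode l k r) = topSize l + suc (topSize r)

data Plug : Top → List Tree → Tree → Set where
  plug-hole : ∀ {T} → Plug hole [ T ] T
  plug-node : ∀ {l ls L k r rs R} → Plug l ls L → Plug r rs R →
              Plug (tnode l k r) (ls ++ rs) (node L k R)

-- One access to x, turning tree T into T' at cost c: a connected
-- subtree τ containing the root and x is touched (c = |τ|) and the touched
-- nodes are rearranged into another BST shape τ' on the same keys, the
-- untouched subtrees hanging off in the same (in-order) positions.
record Step (T : Tree) (x : ℚ) (T' : Tree) (c : ℕ) : Set where
  field
    touched    : Top
    rearranged : Top
    hanging    : List Tree
    before     : Plug touched hanging T
    after      : Plug rearranged hanging T'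
    hasX       : x ∈ topKeys touched
    sameKeys   : topKeys rearranged ≡ topKeys touched
    cost       : c ≡ topSize touched

data Serve (P : Tree → Set) : Tree → List ℚ → ℕ → Set where
  done : ∀ {T} → P T → Serve P T [] 0
  step : ∀ {T T' x xs c c'} → P T → Step T x T' c → Serve P T' xs c' →
         Serve P T (x ∷ xs) (c + c')

-- An (offline) algorithm with key set K serving the access sequence xs
-- at total cost c, maintaining a BST satisfying P at all times.
Execution : (K : ℚ → Set) (P : Tree → Set) → List ℚ → ℕ → Set
Execution K P xs c =
  Σ Tree λ T₀ → HasKeySet T₀ K × Serve (λ T → IsBST T × P T) T₀ xs c

NoCondition : Tree → Set
NoCondition _ = ⊤

IsOPT : (n : ℕ) → List (Fin n) → ℕ → Set
IsOPT n S k =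
  Execution (InRange n) NoCondition (map finKey S) k ×
  (∀ c → Execution (InRange n) NoCondition (map finKey S) c → k ≤ c)

-- Give every key k two auxiliary guard keys lower k < k < upper k, and replace each node k of a
-- BST by a node lower k whose right child is a node upper k with the leaf k on its left.  This
-- makes every original key a leaf, and it commutes with the moves of the model: guarding a touched
-- top part of s nodes and its rearrangement gives a touched top part of 3s nodes and a valid
-- rearrangement of it, with the guarded untouched subtrees hanging in the same places.  So
-- guarding an optimal execution serves S on the enlarged key set at cost exactly 3 OPT(S).

module Submission where

open import Defs
open import Data.Nat using (ℕ; _*_; _≤_)
open import Data.Fin using (Fin)
open import Data.List using (List; map)
open import Data.List.Membership.Propositional using (_∈_)
open import Data.List.Relation.Unary.All using (All)
open import Data.Product using (Σ; _×_)
open import Data.Sum using (_⊎_)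
open import Data.Rational using (ℚ)
open import Relation.Nullary using (¬_)

open import Data.Nat as ℕ using (suc; _+_; _∸_; NonZero; s≤s; z≤n)
import Data.Nat.Properties as ℕP
open import Data.Nat.DivMod using (_%_; [m+kn]%n≡m%n; m*n%n≡0; m<n⇒m%n≡m)
import Data.Nat.Coprimality as Coprime
open import Data.Integer as ℤ using (+_)
import Data.Integer.Properties as ℤP
open import Data.Rational as ℚ using (_/_; ↥_; fromℚᵘ)
import Data.Rational.Properties as ℚP
open import Data.Rational.Unnormalised as ℚᵘ using (mkℚᵘ; *<*; *≡*)
import Data.Rational.Unnormalised.Properties as ℚᵘP
open import Data.List using ([]; _∷_; _++_; length)
import Data.List.Properties as ListP
open import Data.List.Relation.Unary.Any using (here; there)
open import Data.List.Relation.Unary.All using ([]; _∷_; tabulate)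
open import Data.List.Relation.Unary.Linked using (Linked; []; [-]; _∷_)
open import Data.List.Membership.Propositional.Properties using (∈-++⁻)
open import Data.Product using (∃₂; _,_; proj₁)
open import Data.Sum using (inj₁; inj₂)
import Data.Sum as Sum
open import Function.Bundles using (mk⇔; Equivalence)
open import Relation.Binary.PropositionalEquality

interleave : List ℚ → List Tree → List ℚ
interleave _        []       = []
interleave []       (t ∷ _)  = inorder t
interleave (k ∷ ks) (t ∷ ts) = inorder t ++ k ∷ interleave ks ts

Plug-length : ∀ {t ts T} → Plug t ts T → length ts ≡ suc (length (topKeys t))
Plug-length plug-hole = refl
Plug-length (plug-node {l = l} {ls = ls} {k = k} {r = r} {rs = rs} pl pr) = begin
  length (ls ++ rs)                                   ≡⟨ ListP.length-++ ls ⟩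
  length ls + length rs                               ≡⟨ cong₂ _+_ (Plug-length pl) (Plug-length pr) ⟩
  suc (length (topKeys l)) + suc (length (topKeys r)) ≡⟨ cong suc (ListP.length-++ (topKeys l)) ⟨
  suc (length (topKeys l ++ k ∷ topKeys r))           ∎
  where open ≡-Reasoning

interleave-++ : ∀ ks k ls ts us → length ts ≡ suc (length ks) →
  interleave (ks ++ k ∷ ls) (ts ++ us) ≡ interleave ks ts ++ k ∷ interleave ls us
interleave-++ []       k ls (t ∷ [])     us _  = refl
interleave-++ (k′ ∷ ks) k ls (t ∷ ts)    us eq =
  trans (cong (λ xs → inorder t ++ k′ ∷ xs) (interleave-++ ks k ls ts us (ℕP.suc-injective eq)))
        (sym (ListP.++-assoc (inorder t) (k′ ∷ interleave ks ts) _))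

inorder-Plug : ∀ {t ts T} → Plug t ts T → inorder T ≡ interleave (topKeys t) ts
inorder-Plug plug-hole = refl
inorder-Plug (plug-node {l = l} {ls = ls} {k = k} {r = r} {rs = rs} pl pr) =
  trans (cong₂ (λ xs ys → xs ++ k ∷ ys) (inorder-Plug pl) (inorder-Plug pr))
        (sym (interleave-++ (topKeys l) k (topKeys r) ls rs (Plug-length pl)))

Step-inorder : ∀ {T x T′ c} → Step T x T′ c → inorder T′ ≡ inorder T
Step-inorder {T} {T′ = T′} st = begin
  inorder T′                              ≡⟨ inorder-Plug after ⟩
  interleave (topKeys rearranged) hanging ≡⟨ cong (λ ks → interleave ks hanging) sameKeys ⟩
  interleave (topKeys touched) hanging    ≡⟨ inorder-Plug before ⟨
  inorder T                               ∎
  where open Step st; open ≡-Reasoning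

Serve-head : ∀ {P T xs c} → Serve P T xs c → P T
Serve-head (done p)     = p
Serve-head (step p _ _) = p

module Guarding (lower upper : ℚ → ℚ) where

  guardKeys : List ℚ → List ℚ
  guardKeys []       = []
  guardKeys (k ∷ ks) = lower k ∷ k ∷ upper k ∷ guardKeys ks

  guards : List ℚ → List ℚ
  guards []       = []
  guards (k ∷ ks) = lower k ∷ upper k ∷ guards ks

  guardKeys-++ : ∀ ks ls → guardKeys (ks ++ ls) ≡ guardKeys ks ++ guardKeys ls
  guardKeys-++ []       ls = refl
  guardKeys-++ (k ∷ ks) ls = cong (λ gs → lower k ∷ k ∷ upper k ∷ gs) (guardKeys-++ ks ls)

  ∈-guardKeys⁺ : ∀ {q} ks → q ∈ ks ⊎ q ∈ guards ks → q ∈ guardKeys ks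
  ∈-guardKeys⁺ (k ∷ ks) (inj₁ (here q≡k))           = there (here q≡k)
  ∈-guardKeys⁺ (k ∷ ks) (inj₁ (there q∈ks))         =
    there (there (there (∈-guardKeys⁺ ks (inj₁ q∈ks))))
  ∈-guardKeys⁺ (k ∷ ks) (inj₂ (here q≡lo))          = here q≡lo
  ∈-guardKeys⁺ (k ∷ ks) (inj₂ (there (here q≡hi)))  = there (there (here q≡hi))
  ∈-guardKeys⁺ (k ∷ ks) (inj₂ (there (there q∈gs))) =
    there (there (there (∈-guardKeys⁺ ks (inj₂ q∈gs))))

  ∈-guardKeys⁻ : ∀ {q} ks → q ∈ guardKeys ks → q ∈ ks ⊎ q ∈ guards ks
  ∈-guardKeys⁻ (k ∷ ks) (here q≡lo)                 = inj₂ (here q≡lo)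
  ∈-guardKeys⁻ (k ∷ ks) (there (here q≡k))          = inj₁ (here q≡k)
  ∈-guardKeys⁻ (k ∷ ks) (there (there (here q≡hi))) = inj₂ (there (here q≡hi))
  ∈-guardKeys⁻ (k ∷ ks) (there (there (there q∈gk))) =
    Sum.map there (λ q∈gs → there (there q∈gs)) (∈-guardKeys⁻ ks q∈gk)

  leaf : ℚ → Tree
  leaf k = node empty k empty

  guard : Tree → Tree
  guard empty        = empty
  guard (node l k r) = node (guard l) (lower k) (node (leaf k) (upper k) (guard r))

  inorder-guard : ∀ t → inorder (guard t) ≡ guardKeys (inorder t)
  inorder-guard empty        = refl
  inorder-guard (node l k r) = begin
    inorder (guard l) ++ lower k ∷ k ∷ upper k ∷ inorder (guard r)
      ≡⟨ cong₂ (λ ls rs → ls ++ lower k ∷ k ∷ upper k ∷ rs) (inorder-guard l) (inorder-guard r) ⟩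
    guardKeys (inorder l) ++ guardKeys (k ∷ inorder r)
      ≡⟨ guardKeys-++ (inorder l) (k ∷ inorder r) ⟨
    guardKeys (inorder l ++ k ∷ inorder r) ∎
    where open ≡-Reasoning

  ∈-inorder⇒LeafIn-guard : ∀ {q} t → q ∈ inorder t → LeafIn q (guard t)
  ∈-inorder⇒LeafIn-guard (node l k r) q∈t with ∈-++⁻ (inorder l) q∈t
  ... | inj₁ q∈l           = left (∈-inorder⇒LeafIn-guard l q∈l)
  ... | inj₂ (here refl)   = right (left here)
  ... | inj₂ (there q∈r)   = right (right (∈-inorder⇒LeafIn-guard r q∈r))

  HasKeySet-guard : ∀ T {K} → HasKeySet T K → HasKeySet (guard T) (λ q → K q ⊎ q ∈ guards (inorder T))
  HasKeySet-guard T keys q = mk⇔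
    (λ q∈ → Sum.map₁ (Equivalence.to (keys q)) (∈-guardKeys⁻ _ (subst (q ∈_) (inorder-guard T) q∈)))
    (λ q∈ → subst (q ∈_) (sym (inorder-guard T))
              (∈-guardKeys⁺ _ (Sum.map₁ (Equivalence.from (keys q)) q∈)))

  guardTop : Top → Top
  guardTop hole          = hole
  guardTop (tnode l k r) = tnode (guardTop l) (lower k) (tnode (tnode hole k hole) (upper k) (guardTop r))

  topKeys-guardTop : ∀ t → topKeys (guardTop t) ≡ guardKeys (topKeys t)
  topKeys-guardTop hole          = refl
  topKeys-guardTop (tnode l k r) = begin
    topKeys (guardTop l) ++ lower k ∷ k ∷ upper k ∷ topKeys (guardTop r)
      ≡⟨ cong₂ (λ ls rs → ls ++ lower k ∷ k ∷ upper k ∷ rs)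
               (topKeys-guardTop l) (topKeys-guardTop r) ⟩
    guardKeys (topKeys l) ++ guardKeys (k ∷ topKeys r)
      ≡⟨ guardKeys-++ (topKeys l) (k ∷ topKeys r) ⟨
    guardKeys (topKeys l ++ k ∷ topKeys r) ∎
    where open ≡-Reasoning

  topSize-guardTop : ∀ t → topSize (guardTop t) ≡ 3 * topSize t
  topSize-guardTop hole          = refl
  topSize-guardTop (tnode l k r) = begin
    topSize (guardTop l) + (3 + topSize (guardTop r))
      ≡⟨ cong₂ (λ a b → a + (3 + b)) (topSize-guardTop l) (topSize-guardTop r) ⟩
    3 * topSize l + (3 + 3 * topSize r)
      ≡⟨ cong (_+_ (3 * topSize l)) (ℕP.*-suc 3 (topSize r)) ⟨
    3 * topSize l + 3 * suc (topSize r)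
      ≡⟨ ℕP.*-distribˡ-+ 3 (topSize l) (suc (topSize r)) ⟨
    3 * (topSize l + suc (topSize r)) ∎
    where open ≡-Reasoning

  -- The two new holes on either side of each touched key hold empty trees.
  guardHanging : List Tree → List Tree
  guardHanging []           = []
  guardHanging (t ∷ [])     = guard t ∷ []
  guardHanging (t ∷ u ∷ ts) = guard t ∷ empty ∷ empty ∷ guardHanging (u ∷ ts)

  guardHanging-++ : ∀ t ts u us →
    guardHanging ((t ∷ ts) ++ (u ∷ us)) ≡
    guardHanging (t ∷ ts) ++ empty ∷ empty ∷ guardHanging (u ∷ us)
  guardHanging-++ t []       u us = refl
  guardHanging-++ t (v ∷ ts) u us =
    cong (λ gs → guard t ∷ empty ∷ empty ∷ gs) (guardHanging-++ v ts u us)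

  Plug-hanging-nonEmpty : ∀ {t ts T} → Plug t ts T → ∃₂ λ u us → ts ≡ u ∷ us
  Plug-hanging-nonEmpty plug-hole = _ , _ , refl
  Plug-hanging-nonEmpty (plug-node pl pr) with Plug-hanging-nonEmpty pl
  ... | _ , _ , refl = _ , _ , refl

  Plug-guard : ∀ {t ts T} → Plug t ts T → Plug (guardTop t) (guardHanging ts) (guard T)
  Plug-guard plug-hole = plug-hole
  Plug-guard (plug-node pl pr) with Plug-hanging-nonEmpty pl | Plug-hanging-nonEmpty pr
  ... | u , us , refl | v , vs , refl =
    subst (λ hs → Plug _ hs _) (sym (guardHanging-++ u us v vs))
      (plug-node (Plug-guard pl) (plug-node (plug-node plug-hole plug-hole) (Plug-guard pr)))

  Step-guard : ∀ {T x T′ c} → Step T x T′ c → Step (guard T) x (guard T′) (3 * c)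
  Step-guard {x = x} st = record
    { touched    = guardTop touched
    ; rearranged = guardTop rearranged
    ; hanging    = guardHanging hanging
    ; before     = Plug-guard before
    ; after      = Plug-guard after
    ; hasX       = subst (x ∈_) (sym (topKeys-guardTop touched)) (∈-guardKeys⁺ _ (inj₁ hasX))
    ; sameKeys   = trans (topKeys-guardTop rearranged)
                     (trans (cong guardKeys sameKeys) (sym (topKeys-guardTop touched)))
    ; cost       = trans (cong (3 *_) cost) (sym (topSize-guardTop touched))
    }
    where open Step st

  -- Steps preserve the in-order key sequence, so Q is needed only for trees sharing it.
  Serve-guard : ∀ {P Q : Tree → Set} {L T xs c} →
    (∀ T′ → inorder T′ ≡ L → Q (guard T′)) →
    Serve P T xs c → inorder T ≡ L → Serve Q (guard T) xs (3 * c)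
  Serve-guard {T = T} Q-guard (done _) T≡L = done (Q-guard T T≡L)
  Serve-guard {Q = Q} {T = T} Q-guard (step {c = c} {c′} _ st run) T≡L =
    subst (Serve Q (guard T) _) (sym (ℕP.*-distribˡ-+ 3 c c′))
      (step (Q-guard T T≡L) (Step-guard st) (Serve-guard Q-guard run (trans (Step-inorder st) T≡L)))

fromℚᵘ-mono-< : ∀ {p q} → p ℚᵘ.< q → fromℚᵘ p ℚ.< fromℚᵘ q
fromℚᵘ-mono-< {p} {q} p<q = ℚP.toℚᵘ-cancel-<
  (ℚᵘP.<-respˡ-≃ (ℚᵘP.≃-sym (ℚP.toℚᵘ-fromℚᵘ p))
    (ℚᵘP.<-respʳ-≃ (ℚᵘP.≃-sym (ℚP.toℚᵘ-fromℚᵘ q)) p<q))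

fromℚᵘ-cancel-< : ∀ {p q} → fromℚᵘ p ℚ.< fromℚᵘ q → p ℚᵘ.< q
fromℚᵘ-cancel-< {p} {q} p<q =
  ℚᵘP.<-respˡ-≃ (ℚP.toℚᵘ-fromℚᵘ p)
    (ℚᵘP.<-respʳ-≃ (ℚP.toℚᵘ-fromℚᵘ q) (ℚP.toℚᵘ-mono-< p<q))

quarter : ℕ → ℚ
quarter m = + m / 4

quarter-mono-< : ∀ {m n} → m ℕ.< n → quarter m ℚ.< quarter n
quarter-mono-< {m} {n} m<n = fromℚᵘ-mono-< {mkℚᵘ (+ m) 3} {mkℚᵘ (+ n) 3}
  (*<* (subst₂ ℤ._<_ (ℤP.pos-* m 4) (ℤP.pos-* n 4) (ℤ.+<+ (ℕP.*-monoˡ-< 4 m<n))))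

quarter-injective : ∀ {m n} → quarter m ≡ quarter n → m ≡ n
quarter-injective {m} {n} eq = ℕP.*-cancelʳ-≡ m n 4 (ℚP.normalize-injective-≃ m n 4 4 eq)

ℕtoℚ-quarter : ∀ a → ℕtoℚ a ≡ quarter (a * 4)
ℕtoℚ-quarter a = ℚP.fromℚᵘ-cong {mkℚᵘ (+ a) 0} {mkℚᵘ (+ (a * 4)) 3}
  (*≡* (trans (sym (ℤP.pos-* a 4)) (sym (ℤP.*-identityʳ _))))

ℕtoℚ-cancel-< : ∀ {a b} → ℕtoℚ a ℚ.< ℕtoℚ b → a ℕ.< b
ℕtoℚ-cancel-< {a} {b} lt with fromℚᵘ-cancel-< {mkℚᵘ (+ a) 0} {mkℚᵘ (+ b) 0} lt
... | *<* a<b = ℤP.drop‿+<+ (subst₂ ℤ._<_ (ℤP.*-identityʳ (+ a)) (ℤP.*-identityʳ (+ b)) a<b)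

num : ℚ → ℕ
num q = ℤ.∣ ↥ q ∣

num-ℕtoℚ : ∀ a → num (ℕtoℚ a) ≡ a
num-ℕtoℚ a = cong num (ℚP.normalize-coprime {a} {0} (Coprime.sym (Coprime.1-coprimeTo a)))

-- The key a ∈ [n] is the quarter 4a; its guards are the quarters 4a ∓ 1, which are not integers and
-- lie strictly between a and its neighbours a ∓ 1.
lower upper : ℚ → ℚ
lower q = quarter (num q * 4 ∸ 1)
upper q = quarter (suc (num q * 4))

lower-ℕtoℚ : ∀ a → lower (ℕtoℚ (suc a)) ≡ quarter (3 + a * 4)
lower-ℕtoℚ a = cong (λ m → quarter (m * 4 ∸ 1)) (num-ℕtoℚ (suc a))

upper-ℕtoℚ : ∀ a → upper (ℕtoℚ a) ≡ quarter (1 + a * 4)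
upper-ℕtoℚ a = cong (λ m → quarter (suc (m * 4))) (num-ℕtoℚ a)

m+k*n≢l*n : ∀ {m n} k l .{{_ : NonZero n}} → 0 ℕ.< m → m ℕ.< n → m + k * n ≢ l * n
m+k*n≢l*n {m} {n} k l 0<m m<n eq = ℕP.>⇒≢ 0<m (begin
  m                ≡⟨ m<n⇒m%n≡m m<n ⟨
  m % n            ≡⟨ [m+kn]%n≡m%n m k n ⟨
  (m + k * n) % n  ≡⟨ cong (_% n) eq ⟩
  (l * n) % n      ≡⟨ m*n%n≡0 l n ⟩
  0                ∎)
  where open ≡-Reasoning

open Guarding lower upper

module _ {n : ℕ} where

  lower-∉ : ∀ {k} → InRange n k → ¬ InRange n (lower k)
  lower-∉ (suc a , _ , _ , refl) (b , _ , _ , eq) = m+k*n≢l*n {3} a b (s≤s z≤n) ℕP.≤-refl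
    (quarter-injective (trans (sym (lower-ℕtoℚ a)) (trans eq (ℕtoℚ-quarter b))))

  upper-∉ : ∀ {k} → InRange n k → ¬ InRange n (upper k)
  upper-∉ (a , _ , _ , refl) (b , _ , _ , eq) = m+k*n≢l*n {1} a b ℕP.≤-refl (s≤s (s≤s z≤n))
    (quarter-injective (trans (sym (upper-ℕtoℚ a)) (trans eq (ℕtoℚ-quarter b))))

  lower-< : ∀ {k} → InRange n k → lower k ℚ.< k
  lower-< (suc a , _ , _ , refl) =
    subst₂ ℚ._<_ (sym (lower-ℕtoℚ a)) (sym (ℕtoℚ-quarter (suc a)))
      (quarter-mono-< {3 + a * 4} ℕP.≤-refl)

  <-upper : ∀ {k} → InRange n k → k ℚ.< upper k
  <-upper (a , _ , _ , refl) =
    subst₂ ℚ._<_ (sym (ℕtoℚ-quarter a)) (sym (upper-ℕtoℚ a))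
      (quarter-mono-< {a * 4} ℕP.≤-refl)

  upper-<-lower : ∀ {k k′} → InRange n k → InRange n k′ → k ℚ.< k′ → upper k ℚ.< lower k′
  upper-<-lower (a , _ , _ , refl) (suc b , _ , _ , refl) k<k′ =
    subst₂ ℚ._<_ (sym (upper-ℕtoℚ a)) (sym (lower-ℕtoℚ b)) (quarter-mono-< 1+4a<3+4b)
    where
    a≤b : a ℕ.≤ b
    a≤b = ℕP.≤-pred (ℕtoℚ-cancel-< k<k′)
    1+4a<3+4b : 1 + a * 4 ℕ.< 3 + b * 4
    1+4a<3+4b = s≤s (s≤s (ℕP.m≤n⇒m≤1+n (ℕP.*-monoˡ-≤ 4 a≤b)))

  guardKeys-sorted : ∀ {ks} → Linked ℚ._<_ ks → All (InRange n) ks → Linked ℚ._<_ (guardKeys ks)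
  guardKeys-sorted {[]}     _ _ = []
  guardKeys-sorted {_ ∷ []} _ (k∈ ∷ _) = lower-< k∈ ∷ <-upper k∈ ∷ [-]
  guardKeys-sorted {_ ∷ _ ∷ _} (k<k′ ∷ sorted) (k∈ ∷ k′∈ ∷ ks∈) =
    lower-< k∈ ∷ <-upper k∈ ∷ upper-<-lower k∈ k′∈ k<k′ ∷
    guardKeys-sorted sorted (k′∈ ∷ ks∈)

  guards-∉ : ∀ {ks} → All (InRange n) ks → All (λ q → ¬ InRange n q) (guards ks)
  guards-∉ []         = []
  guards-∉ (k∈ ∷ ks∈) = lower-∉ k∈ ∷ upper-∉ k∈ ∷ guards-∉ ks∈

  guard-invariant : ∀ {L} → Linked ℚ._<_ L → All (InRange n) L → (∀ q → InRange n q → q ∈ L) →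
    ∀ T → inorder T ≡ L → IsBST (guard T) × (∀ q → InRange n q → LeafIn q (guard T))
  guard-invariant sorted L∈ complete T refl =
    subst (Linked ℚ._<_) (sym (inorder-guard T)) (guardKeys-sorted sorted L∈) ,
    λ q q∈ → ∈-inorder⇒LeafIn-guard T (complete q q∈)

mainTheorem17 : (n : ℕ) (S : List (Fin n)) (opt : ℕ) → IsOPT n S opt →
    Σ (List ℚ) λ X → All (λ q → ¬ InRange n q) X ×
      Σ ℕ λ c → Execution (λ q → InRange n q ⊎ q ∈ X)
                          (λ T → ∀ q → InRange n q → LeafIn q T)
                          (map finKey S) c
                × c ≤ 3 * opt
mainTheorem17 n S opt ((T₀ , keys₀ , run) , _) =
  guards L , guards-∉ L∈ , 3 * opt ,
  (guard T₀ , HasKeySet-guard T₀ keys₀ , Serve-guard (guard-invariant sorted L∈ complete) run refl) ,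
  ℕP.≤-refl
  where
  L : List ℚ
  L = inorder T₀
  sorted : Linked ℚ._<_ L
  sorted = proj₁ (Serve-head run)
  L∈ : All (InRange n) L
  L∈ = tabulate λ {q} → Equivalence.to (keys₀ q)
  complete : ∀ q → InRange n q → q ∈ L
  complete q = Equivalence.from (keys₀ q)
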